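{- Let $t$ and $\lambda$ be positive integers with $t \ge \lambda+1$. Then a digraph is a $(t,\lambda)$-liking digraph if and only if it is a two-way $(t,\lambda)$-liking digraph.
   Context: All digraphs are finite, with no loops and no multiple arcs. For positive integers $t$ and $\lambda$, a digraph is a $(t,\lambda)$-liking digraph if every set of $t$ distinct vertices has exactly $\lambda$ common out-neighbors, and it is a two-way $(t,\lambda)$-liking digraph if every set of $t$ distinct vertices has exactly $\lambda$ common out-neighbors and exactly $\lambda$ common in-neighbors. -}

module Defs where

open import Data.Nat using (ℕ)
open import Data.Bool using (Bool; true; false; _∧_; T; not)
open import Data.Fin using (Fin)
open import Data.Fin.Subset using (Subset; ∣_∣; _∈_; inside; outside)
open import Data.Vec using (tabulate; lookup)
open import Data.List using (List; foldr)
open import Data.List.Base using (map)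
open import Data.Fin.Base using ()
open import Data.Vec.Base using (toList)
open import Data.Vec using (allFin)
open import Relation.Binary.PropositionalEquality using (_≡_)

record Digraph (n : ℕ) : Set where
  field
    arc      : Fin n → Fin n → Bool
    loopless : ∀ v → arc v v ≡ false

open Digraph public

allIn : ∀ {n} → Subset n → (Fin n → Bool) → Bool
allIn {n} S p = foldr _∧_ true (map (λ u → not (isIn u) Data.Bool.∨ p u) (toList (allFin n)))
  where
    isIn : Fin n → Bool
    isIn u with lookup S u
    ... | inside  = true
    ... | outside = false

commonOut : ∀ {n} → Digraph n → Subset n → Subset n
commonOut G S = tabulate (λ v → if allIn S (λ u → arc G u v) then inside else outside)
  where open import Data.Bool using (if_then_else_)

commonIn : ∀ {n} → Digraph n → Subset n → Subset n
commonIn G S = tabulate (λ v → if allIn S (λ u → arc G v u) then inside else outside)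
  where open import Data.Bool using (if_then_else_)

Liking : ∀ {n} → ℕ → ℕ → Digraph n → Set
Liking t λ' G = ∀ (S : Subset _) → ∣ S ∣ ≡ t → ∣ commonOut G S ∣ ≡ λ'

TwoWayLiking : ∀ {n} → ℕ → ℕ → Digraph n → Set
TwoWayLiking t λ' G = ∀ (S : Subset _) → ∣ S ∣ ≡ t →
  (∣ commonOut G S ∣ ≡ λ') Data.Product.× (∣ commonIn G S ∣ ≡ λ')
  where import Data.Product

-- Write t = j + λ + 1 (λ is l in the code) and fix a j-set R. Let L be the common out-neighbourhood
-- of R, B w the in-neighbours of w outside R, O w the out-neighbours of w in L, and M Y the common
-- in-neighbours of Y outside R. For w ∈ L, Λ ↦ commonOut (R ∪ Λ ∪ {w}) injects the λ-subsets of B w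
-- into those of O w; since λ ≥ 1 this gives C(|B w|, λ+1) ≤ C(|O w|, λ+1). Double counting then yields
--   λ C(|∁R|, λ+1) = Σ_{w ∈ L} C(|B w|, λ+1) ≤ Σ_{x ∉ R} C(|O x|, λ+1) = Σ_{Y ⊆ L, |Y| = λ+1} |M Y|
--                  ≤ λ C(|L|, λ+1),
-- where |M Y| ≤ λ because Y lies in the common out-neighbourhood of R together with any (λ+1)-subset
-- of M Y. So everything is tight: L = ∁R and |M Y| = λ. Finally, for a t-set W = R ∪ Y the common
-- in-neighbours of W are exactly M Y: a vertex x ∉ R dominating Y also dominates every u ∈ R, as u lies
-- outside the j-set R − u + x, whose complement is contained in its common out-neighbourhood.

module Submission where

open import Defs

open import Data.Bool using (Bool; true; T; if_then_else_)
open import Data.Bool.Properties using (T?) renaming (_≟_ to _≟ᵇ_)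
open import Data.Empty using (⊥-elim)
open import Data.Fin using (Fin; zero; suc)
open import Data.Fin.Subset using (Subset; inside; outside; _∈_; _∉_; _⊆_; _∪_; _∩_; ∁; ⁅_⁆; ∣_∣; ⊥)
open import Data.Fin.Subset.Properties
open import Data.List.Relation.Unary.All as All using ()
open import Data.List.Relation.Unary.All.Properties using (all⁺; all⁻; ¬All⇒Any¬)
open import Data.List.Relation.Unary.Any using (satisfied)
open import Data.Nat
  using (ℕ; zero; suc; _+_; _*_; _∸_; _≤_; _<_; _≤?_; _≤′_; ≤′-refl; ≤′-step; z≤n; s≤s; >-nonZero)
open import Data.Nat.Combinatorics using (_C_; nCk+nC[k+1]≡[n+1]C[k+1]; k>n⇒nCk≡0)
open import Data.Nat.Properties
open import Algebra.Properties.CommutativeSemigroup +-commutativeSemigroup using (interchange)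
open import Algebra.Properties.Semiring.Sum +-*-semiring
  using (sum-syntax; sum-cong-≗; ∑-distrib-+; *-distribˡ-sum)
open import Data.Product using (_×_; _,_; ∃; proj₁; proj₂)
open import Data.Sum using (inj₁; inj₂; [_,_])
open import Data.Vec using ([]; _∷_; here; there; lookup; tabulate; allFin; toList)
open import Data.Vec.Membership.Propositional.Properties using (∈-allFin⁺; ∈-toList⁺)
open import Data.Vec.Properties using (≡-dec; ∷-injectiveʳ; []=⇒lookup; lookup⇒[]=; lookup∘tabulate)
open import Function using (_∘_; id; case_of_; _⇔_; mk⇔; Equivalence)
open import Level using (Level)
open import Relation.Binary.PropositionalEquality
  using (_≡_; refl; sym; trans; cong; cong₂; subst; module ≡-Reasoning)
open import Relation.Nullary using (Dec; does; yes; no; ¬_; _×-dec_; contradiction)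

private
  variable
    a b : Level
    P : Set a
    Q : Set b
    k m n : ℕ
    p q r : Subset n

𝟙 : Dec P → ℕ
𝟙 d = if does d then 1 else 0

𝟙-yes : (d : Dec P) → P → 𝟙 d ≡ 1
𝟙-yes (yes _) _ = refl
𝟙-yes (no ¬x) x = ⊥-elim (¬x x)

𝟙-no : (d : Dec P) → ¬ P → 𝟙 d ≡ 0
𝟙-no (yes x) ¬x = ⊥-elim (¬x x)
𝟙-no (no _)  _  = refl

𝟙-mono : (d : Dec P) (e : Dec Q) → (P → Q) → 𝟙 d ≤ 𝟙 e
𝟙-mono (yes x) (yes _) _   = ≤-refl
𝟙-mono (yes x) (no ¬y) P→Q = ⊥-elim (¬y (P→Q x))
𝟙-mono (no _)  _       _   = z≤n

𝟙-cong : (d : Dec P) (e : Dec Q) → P ⇔ Q → 𝟙 d ≡ 𝟙 e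
𝟙-cong d e P⇔Q = ≤-antisym (𝟙-mono d e (Equivalence.to P⇔Q)) (𝟙-mono e d (Equivalence.from P⇔Q))

𝟙-* : (d : Dec P) (e : Dec Q) → 𝟙 d * 𝟙 e ≡ 𝟙 (d ×-dec e)
𝟙-* (yes _) (yes _) = refl
𝟙-* (yes _) (no _)  = refl
𝟙-* (no _)  _       = refl

𝟙-*-mono : ∀ {x y} (d : Dec P) (e : Dec Q) → (P → Q) → (P → x ≤ y) → 𝟙 d * x ≤ 𝟙 e * y
𝟙-*-mono (yes a) e P→Q x≤y rewrite 𝟙-yes e (P→Q a) = *-monoʳ-≤ 1 (x≤y a)
𝟙-*-mono (no _)  e _   _   = z≤n

𝟙-*-cong : ∀ {x y} (d : Dec P) → (P → x ≡ y) → 𝟙 d * x ≡ 𝟙 d * y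
𝟙-*-cong (yes a) x≡y = cong (1 *_) (x≡y a)
𝟙-*-cong (no _)  _   = refl

∑ₛ : (Subset m → ℕ) → ℕ
∑ₛ {zero}  f = f []
∑ₛ {suc m} f = ∑ₛ (f ∘ (inside ∷_)) + ∑ₛ (f ∘ (outside ∷_))

∑ₛ-cong : {f g : Subset m → ℕ} → (∀ X → f X ≡ g X) → ∑ₛ f ≡ ∑ₛ g
∑ₛ-cong {zero}  f≗g = f≗g []
∑ₛ-cong {suc m} f≗g = cong₂ _+_ (∑ₛ-cong (f≗g ∘ (inside ∷_))) (∑ₛ-cong (f≗g ∘ (outside ∷_)))

∑ₛ-mono-≤ : {f g : Subset m → ℕ} → (∀ X → f X ≤ g X) → ∑ₛ f ≤ ∑ₛ g
∑ₛ-mono-≤ {zero}  f≤g = f≤g []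
∑ₛ-mono-≤ {suc m} f≤g = +-mono-≤ (∑ₛ-mono-≤ (f≤g ∘ (inside ∷_))) (∑ₛ-mono-≤ (f≤g ∘ (outside ∷_)))

∑ₛ-0 : ∑ₛ {m} (λ _ → 0) ≡ 0
∑ₛ-0 {zero}  = refl
∑ₛ-0 {suc m} = cong₂ _+_ (∑ₛ-0 {m}) (∑ₛ-0 {m})

∑ₛ-𝟙-none : {P : Subset m → Set a} (P? : ∀ X → Dec (P X)) → (∀ X → ¬ P X) → ∑ₛ (λ X → 𝟙 (P? X)) ≡ 0
∑ₛ-𝟙-none {m} P? ∄P = trans (∑ₛ-cong λ X → 𝟙-no (P? X) (∄P X)) (∑ₛ-0 {m})

∑ₛ-𝟙-cong : {P : Subset m → Set a} {Q : Subset m → Set b} (P? : ∀ X → Dec (P X)) (Q? : ∀ X → Dec (Q X)) →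
            (∀ X → P X ⇔ Q X) → ∑ₛ (λ X → 𝟙 (P? X)) ≡ ∑ₛ (λ X → 𝟙 (Q? X))
∑ₛ-𝟙-cong P? Q? P⇔Q = ∑ₛ-cong λ X → 𝟙-cong (P? X) (Q? X) (P⇔Q X)

∑ₛ-distrib-+ : (f g : Subset m → ℕ) → ∑ₛ (λ X → f X + g X) ≡ ∑ₛ f + ∑ₛ g
∑ₛ-distrib-+ {zero}  f g = refl
∑ₛ-distrib-+ {suc m} f g = begin
  ∑ₛ (λ X → f (inside ∷ X) + g (inside ∷ X)) + ∑ₛ (λ X → f (outside ∷ X) + g (outside ∷ X))
    ≡⟨ cong₂ _+_ (∑ₛ-distrib-+ (f ∘ (inside ∷_)) (g ∘ (inside ∷_)))
                 (∑ₛ-distrib-+ (f ∘ (outside ∷_)) (g ∘ (outside ∷_))) ⟩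
  (∑ₛ (f ∘ (inside ∷_)) + ∑ₛ (g ∘ (inside ∷_))) + (∑ₛ (f ∘ (outside ∷_)) + ∑ₛ (g ∘ (outside ∷_)))
    ≡⟨ interchange (∑ₛ (f ∘ (inside ∷_))) _ _ _ ⟩
  ∑ₛ f + ∑ₛ g ∎
  where open ≡-Reasoning

*-distribˡ-∑ₛ : ∀ c (f : Subset m → ℕ) → c * ∑ₛ f ≡ ∑ₛ (λ X → c * f X)
*-distribˡ-∑ₛ {zero}  c f = refl
*-distribˡ-∑ₛ {suc m} c f =
  trans (*-distribˡ-+ c _ _)
        (cong₂ _+_ (*-distribˡ-∑ₛ c (f ∘ (inside ∷_))) (*-distribˡ-∑ₛ c (f ∘ (outside ∷_))))

∑-mono-≤ : {f g : Fin n → ℕ} → (∀ i → f i ≤ g i) → ∑[ i < n ] f i ≤ ∑[ i < n ] g i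
∑-mono-≤ {zero}  _   = z≤n
∑-mono-≤ {suc n} f≤g = +-mono-≤ (f≤g zero) (∑-mono-≤ (f≤g ∘ suc))

∑-∑ₛ-comm : (f : Fin n → Subset m → ℕ) → ∑[ i < n ] ∑ₛ (f i) ≡ ∑ₛ (λ X → ∑[ i < n ] f i X)
∑-∑ₛ-comm {m = zero}  f = refl
∑-∑ₛ-comm {m = suc m} f = trans (∑-distrib-+ (λ i → ∑ₛ (f i ∘ (inside ∷_))) (λ i → ∑ₛ (f i ∘ (outside ∷_))))
  (cong₂ _+_ (∑-∑ₛ-comm (λ i → f i ∘ (inside ∷_))) (∑-∑ₛ-comm (λ i → f i ∘ (outside ∷_))))

∑ₛ-comm : (f : Subset m → Subset n → ℕ) → ∑ₛ (λ X → ∑ₛ (f X)) ≡ ∑ₛ (λ Y → ∑ₛ (λ X → f X Y))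
∑ₛ-comm {n = zero}  f = refl
∑ₛ-comm {n = suc n} f = trans (∑ₛ-distrib-+ (λ X → ∑ₛ (f X ∘ (inside ∷_))) (λ X → ∑ₛ (f X ∘ (outside ∷_))))
  (cong₂ _+_ (∑ₛ-comm (λ X → f X ∘ (inside ∷_))) (∑ₛ-comm (λ X → f X ∘ (outside ∷_))))

+-≤-≡⇒≡ : ∀ {w x y z} → w ≤ y → x ≤ z → w + x ≡ y + z → w ≡ y × x ≡ z
+-≤-≡⇒≡ {w} {x} {y} {z} w≤y x≤z eq =
  ≤-antisym w≤y (+-cancelʳ-≤ x y w (≤-trans (+-monoʳ-≤ y x≤z) (≤-reflexive (sym eq)))) ,
  ≤-antisym x≤z (+-cancelˡ-≤ w z x (≤-trans (+-monoˡ-≤ z w≤y) (≤-reflexive (sym eq))))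

∑ₛ-≤-≡⇒≗ : {f g : Subset m → ℕ} → (∀ X → f X ≤ g X) → ∑ₛ f ≡ ∑ₛ g → ∀ X → f X ≡ g X
∑ₛ-≤-≡⇒≗ {zero}  f≤g eq [] = eq
∑ₛ-≤-≡⇒≗ {suc m} f≤g eq (s ∷ X)
  with +-≤-≡⇒≡ (∑ₛ-mono-≤ (f≤g ∘ (inside ∷_))) (∑ₛ-mono-≤ (f≤g ∘ (outside ∷_))) eq
... | eqᵢ , eqₒ with s
...   | inside  = ∑ₛ-≤-≡⇒≗ (f≤g ∘ (inside ∷_)) eqᵢ X
...   | outside = ∑ₛ-≤-≡⇒≗ (f≤g ∘ (outside ∷_)) eqₒ X

infix 4 _≟ₛ_
_≟ₛ_ : (X Y : Subset m) → Dec (X ≡ Y)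
_≟ₛ_ = ≡-dec _≟ᵇ_

∑ₛ-𝟙-≟ₛ : (Y : Subset m) → ∑ₛ (λ X → 𝟙 (X ≟ₛ Y)) ≡ 1
∑ₛ-𝟙-≟ₛ []            = refl
∑ₛ-𝟙-≟ₛ (inside  ∷ Y) = cong₂ _+_
  (trans (∑ₛ-𝟙-cong (λ X → inside ∷ X ≟ₛ inside ∷ Y) (_≟ₛ Y) λ X → mk⇔ ∷-injectiveʳ (cong (inside ∷_)))
         (∑ₛ-𝟙-≟ₛ Y))
  (∑ₛ-𝟙-none (λ X → outside ∷ X ≟ₛ inside ∷ Y) λ X ())
∑ₛ-𝟙-≟ₛ (outside ∷ Y) = cong₂ _+_
  (∑ₛ-𝟙-none (λ X → inside ∷ X ≟ₛ outside ∷ Y) λ X ())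
  (trans (∑ₛ-𝟙-cong (λ X → outside ∷ X ≟ₛ outside ∷ Y) (_≟ₛ Y) λ X → mk⇔ ∷-injectiveʳ (cong (outside ∷_)))
         (∑ₛ-𝟙-≟ₛ Y))

∑ₛ-𝟙-unique : {P : Subset m → Set a} (P? : ∀ X → Dec (P X)) →
              (∀ {X Y} → P X → P Y → X ≡ Y) → ∑ₛ (λ X → 𝟙 (P? X)) ≤ 𝟙 (anySubset? P?)
∑ₛ-𝟙-unique P? unique with anySubset? P?
... | no ∄P = ≤-reflexive (∑ₛ-𝟙-none P? λ X PX → ∄P (X , PX))
... | yes (Y , PY) = begin
  ∑ₛ (λ X → 𝟙 (P? X))    ≤⟨ ∑ₛ-mono-≤ (λ X → 𝟙-mono (P? X) (X ≟ₛ Y) λ PX → unique PX PY) ⟩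
  ∑ₛ (λ X → 𝟙 (X ≟ₛ Y))  ≡⟨ ∑ₛ-𝟙-≟ₛ Y ⟩
  1                      ∎
  where open ≤-Reasoning

∑ₛ-𝟙-injection : {P : Subset m → Set a} {Q : Subset n → Set b}
                 (P? : ∀ X → Dec (P X)) (Q? : ∀ Y → Dec (Q Y)) (f : Subset m → Subset n) →
                 (∀ {X} → P X → Q (f X)) → (∀ {X X′} → P X → P X′ → f X ≡ f X′ → X ≡ X′) →
                 ∑ₛ (λ X → 𝟙 (P? X)) ≤ ∑ₛ (λ Y → 𝟙 (Q? Y))
∑ₛ-𝟙-injection {Q = Q} P? Q? f maps-to injective = begin
  ∑ₛ (λ X → 𝟙 (P? X))
    ≡⟨ ∑ₛ-cong (λ X → trans (cong (𝟙 (P? X) *_) (∑ₛ-𝟙-≟ₛ (f X))) (*-identityʳ _)) ⟨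
  ∑ₛ (λ X → 𝟙 (P? X) * ∑ₛ (λ Y → 𝟙 (Y ≟ₛ f X)))
    ≡⟨ ∑ₛ-cong (λ X → *-distribˡ-∑ₛ (𝟙 (P? X)) (λ Y → 𝟙 (Y ≟ₛ f X))) ⟩
  ∑ₛ (λ X → ∑ₛ (λ Y → 𝟙 (P? X) * 𝟙 (Y ≟ₛ f X)))
    ≡⟨ ∑ₛ-comm (λ X Y → 𝟙 (P? X) * 𝟙 (Y ≟ₛ f X)) ⟩
  ∑ₛ (λ Y → ∑ₛ (λ X → 𝟙 (P? X) * 𝟙 (Y ≟ₛ f X)))
    ≡⟨ ∑ₛ-cong (λ Y → ∑ₛ-cong λ X → 𝟙-* (P? X) (Y ≟ₛ f X)) ⟩
  ∑ₛ (λ Y → ∑ₛ (λ X → 𝟙 (P? X ×-dec Y ≟ₛ f X)))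
    ≤⟨ ∑ₛ-mono-≤ (λ Y → ∑ₛ-𝟙-unique (λ X → P? X ×-dec Y ≟ₛ f X)
                     λ (PX , Y≡fX) (PX′ , Y≡fX′) → injective PX PX′ (trans (sym Y≡fX) Y≡fX′)) ⟩
  ∑ₛ (λ Y → 𝟙 (anySubset? λ X → P? X ×-dec Y ≟ₛ f X))
    ≤⟨ ∑ₛ-mono-≤ (λ Y → 𝟙-mono (anySubset? λ X → P? X ×-dec Y ≟ₛ f X) (Q? Y)
                     λ (X , PX , Y≡fX) → subst Q (sym Y≡fX) (maps-to PX)) ⟩
  ∑ₛ (λ Y → 𝟙 (Q? Y))
    ∎
  where open ≤-Reasoning

∑-𝟙*∑ₛ-𝟙-swap :
  {A : Fin n → Set} {B : Fin n → Subset m → Set} {C : Subset m → Set} {D : Subset m → Fin n → Set}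
  (A? : ∀ w → Dec (A w)) (B? : ∀ w X → Dec (B w X)) (C? : ∀ X → Dec (C X)) (D? : ∀ X w → Dec (D X w)) →
  (∀ w X → (A w × B w X) ⇔ (C X × D X w)) →
  ∑[ w < n ] (𝟙 (A? w) * ∑ₛ (λ X → 𝟙 (B? w X))) ≡ ∑ₛ (λ X → 𝟙 (C? X) * ∑[ w < n ] 𝟙 (D? X w))
∑-𝟙*∑ₛ-𝟙-swap {n = n} A? B? C? D? AB⇔CD = begin
  ∑[ w < n ] (𝟙 (A? w) * ∑ₛ (λ X → 𝟙 (B? w X)))
    ≡⟨ sum-cong-≗ (λ w → *-distribˡ-∑ₛ (𝟙 (A? w)) (λ X → 𝟙 (B? w X))) ⟩
  ∑[ w < n ] ∑ₛ (λ X → 𝟙 (A? w) * 𝟙 (B? w X))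
    ≡⟨ sum-cong-≗ (λ w → ∑ₛ-cong λ X → 𝟙*𝟙-cong w X) ⟩
  ∑[ w < n ] ∑ₛ (λ X → 𝟙 (C? X) * 𝟙 (D? X w))
    ≡⟨ ∑-∑ₛ-comm (λ w X → 𝟙 (C? X) * 𝟙 (D? X w)) ⟩
  ∑ₛ (λ X → ∑[ w < n ] (𝟙 (C? X) * 𝟙 (D? X w)))
    ≡⟨ ∑ₛ-cong (λ X → *-distribˡ-sum (𝟙 (C? X)) (λ w → 𝟙 (D? X w))) ⟨
  ∑ₛ (λ X → 𝟙 (C? X) * ∑[ w < n ] 𝟙 (D? X w))
    ∎
  where
  open ≡-Reasoning
  𝟙*𝟙-cong : ∀ w X → 𝟙 (A? w) * 𝟙 (B? w X) ≡ 𝟙 (C? X) * 𝟙 (D? X w)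
  𝟙*𝟙-cong w X = begin
    𝟙 (A? w) * 𝟙 (B? w X)     ≡⟨ 𝟙-* (A? w) (B? w X) ⟩
    𝟙 (A? w ×-dec B? w X)     ≡⟨ 𝟙-cong (A? w ×-dec B? w X) (C? X ×-dec D? X w) (AB⇔CD w X) ⟩
    𝟙 (C? X ×-dec D? X w)     ≡⟨ 𝟙-* (C? X) (D? X w) ⟨
    𝟙 (C? X) * 𝟙 (D? X w)     ∎


infix 4 _⊆[_]_ _⊆[_]?_

_⊆[_]_ : Subset n → ℕ → Subset n → Set
X ⊆[ k ] A = X ⊆ A × ∣ X ∣ ≡ k

_⊆[_]?_ : (X : Subset n) (k : ℕ) (A : Subset n) → Dec (X ⊆[ k ] A)
X ⊆[ k ]? A = X ⊆? A ×-dec ∣ X ∣ ≟ k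

outside∷-⊆[] : ∀ {s} {X A : Subset n} → outside ∷ X ⊆[ k ] s ∷ A ⇔ X ⊆[ k ] A
outside∷-⊆[] = mk⇔ (λ (X⊆A , ∣X∣≡k) → drop-∷-⊆ X⊆A , ∣X∣≡k)
                   (λ (X⊆A , ∣X∣≡k) → out⊆ X⊆A , ∣X∣≡k)

inside∷-⊆[] : {X A : Subset n} → inside ∷ X ⊆[ suc k ] inside ∷ A ⇔ X ⊆[ k ] A
inside∷-⊆[] = mk⇔ (λ (X⊆A , ∣X∣≡k) → drop-∷-⊆ X⊆A , suc-injective ∣X∣≡k)
                  (λ (X⊆A , ∣X∣≡k) → in⊆in X⊆A , cong suc ∣X∣≡k)

∑ₛ-⊆[]≡C : ∀ k (A : Subset n) → ∑ₛ (λ X → 𝟙 (X ⊆[ k ]? A)) ≡ ∣ A ∣ C k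
∑ₛ-⊆[]≡C zero    []            = 𝟙-yes ([] ⊆[ 0 ]? []) ((λ ()) , refl)
∑ₛ-⊆[]≡C (suc k) []            = 𝟙-no ([] ⊆[ suc k ]? []) λ ()
∑ₛ-⊆[]≡C k       (outside ∷ A) = cong₂ _+_
  (∑ₛ-𝟙-none (λ X → inside ∷ X ⊆[ k ]? outside ∷ A) λ X (X⊆A , _) → case X⊆A here of λ ())
  (trans (∑ₛ-𝟙-cong (λ X → outside ∷ X ⊆[ k ]? outside ∷ A) (_⊆[ k ]? A) λ X → outside∷-⊆[]) (∑ₛ-⊆[]≡C k A))
∑ₛ-⊆[]≡C zero    (inside ∷ A)  = cong₂ _+_
  (∑ₛ-𝟙-none (λ X → inside ∷ X ⊆[ 0 ]? inside ∷ A) λ X ())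
  (trans (∑ₛ-𝟙-cong (λ X → outside ∷ X ⊆[ 0 ]? inside ∷ A) (_⊆[ 0 ]? A) λ X → outside∷-⊆[]) (∑ₛ-⊆[]≡C 0 A))
∑ₛ-⊆[]≡C (suc k) (inside ∷ A)  = begin
  ∑ₛ (λ X → 𝟙 (inside ∷ X ⊆[ suc k ]? inside ∷ A)) + ∑ₛ (λ X → 𝟙 (outside ∷ X ⊆[ suc k ]? inside ∷ A))
    ≡⟨ cong₂ _+_ (∑ₛ-𝟙-cong (λ X → inside ∷ X ⊆[ suc k ]? inside ∷ A) (_⊆[ k ]? A) λ X → inside∷-⊆[])
                 (∑ₛ-𝟙-cong (λ X → outside ∷ X ⊆[ suc k ]? inside ∷ A) (_⊆[ suc k ]? A) λ X → outside∷-⊆[]) ⟩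
  ∑ₛ (λ X → 𝟙 (X ⊆[ k ]? A)) + ∑ₛ (λ X → 𝟙 (X ⊆[ suc k ]? A))
    ≡⟨ cong₂ _+_ (∑ₛ-⊆[]≡C k A) (∑ₛ-⊆[]≡C (suc k) A) ⟩
  ∣ A ∣ C k + ∣ A ∣ C suc k
    ≡⟨ nCk+nC[k+1]≡[n+1]C[k+1] ∣ A ∣ k ⟩
  suc ∣ A ∣ C suc k
    ∎
  where open ≡-Reasoning

∑ₛ-⊆[]*≡*C : ∀ c k (A : Subset n) → ∑ₛ (λ X → 𝟙 (X ⊆[ k ]? A) * c) ≡ c * (∣ A ∣ C k)
∑ₛ-⊆[]*≡*C c k A = begin
  ∑ₛ (λ X → 𝟙 (X ⊆[ k ]? A) * c)   ≡⟨ ∑ₛ-cong (λ X → *-comm (𝟙 (X ⊆[ k ]? A)) c) ⟩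
  ∑ₛ (λ X → c * 𝟙 (X ⊆[ k ]? A))   ≡⟨ *-distribˡ-∑ₛ c (λ X → 𝟙 (X ⊆[ k ]? A)) ⟨
  c * ∑ₛ (λ X → 𝟙 (X ⊆[ k ]? A))   ≡⟨ cong (c *_) (∑ₛ-⊆[]≡C k A) ⟩
  c * (∣ A ∣ C k)                  ∎
  where open ≡-Reasoning

choose : ∀ {k} (A : Subset n) → k ≤ ∣ A ∣ → ∃ (_⊆[ k ] A)
choose {n} {k = zero}  A      _           = ⊥ , ⊥⊆ , ∣⊥∣≡0 n
choose {k = suc k} (inside ∷ A)  (s≤s k≤∣A∣) with choose A k≤∣A∣
... | X , X⊆A , ∣X∣≡k = inside ∷ X , in⊆in X⊆A , cong suc ∣X∣≡k
choose {k = suc k} (outside ∷ A) k<∣A∣       with choose A k<∣A∣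
... | X , X⊆A , ∣X∣≡k = outside ∷ X , out⊆ X⊆A , ∣X∣≡k

p⊆q∧∣q∣≤∣p∣⇒q⊆p : p ⊆ q → ∣ q ∣ ≤ ∣ p ∣ → q ⊆ p
p⊆q∧∣q∣≤∣p∣⇒q⊆p {p = p} p⊆q ∣q∣≤∣p∣ {x} x∈q with x ∈? p
... | yes x∈p = x∈p
... | no  x∉p = contradiction ∣q∣≤∣p∣ (<⇒≱ (p⊂q⇒∣p∣<∣q∣ (p⊆q , x , x∈q , x∉p)))

⊆-∩ : r ⊆ p ∩ q ⇔ (r ⊆ p × r ⊆ q)
⊆-∩ {r = r} {p = p} {q = q} = mk⇔ to from
  where
  to : r ⊆ p ∩ q → r ⊆ p × r ⊆ q
  to r⊆p∩q = p∩q⊆p p q ∘ r⊆p∩q , p∩q⊆q p q ∘ r⊆p∩q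
  from : r ⊆ p × r ⊆ q → r ⊆ p ∩ q
  from (r⊆p , r⊆q) x∈r = x∈p∩q⁺ (r⊆p x∈r , r⊆q x∈r)

∪-⊆ : p ⊆ r → q ⊆ r → p ∪ q ⊆ r
∪-⊆ {p = p} {q = q} p⊆r q⊆r x∈ = [ p⊆r , q⊆r ] (x∈p∪q⁻ p q x∈)

x∈p⇒⁅x⁆⊆p : ∀ {x} → x ∈ p → ⁅ x ⁆ ⊆ p
x∈p⇒⁅x⁆⊆p {p = p} {x} x∈p y∈⁅x⁆ = subst (_∈ p) (sym (x∈⁅y⁆⇒x≡y x y∈⁅x⁆)) x∈p

∣p∪q∣≡∣p∣+∣q∣ : (∀ {x} → x ∈ p → x ∉ q) → ∣ p ∪ q ∣ ≡ ∣ p ∣ + ∣ q ∣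
∣p∪q∣≡∣p∣+∣q∣ {p = []} {q = []}        _        = refl
∣p∪q∣≡∣p∣+∣q∣ {p = inside  ∷ p} {q = inside  ∷ q} disjoint = contradiction here (disjoint here)
∣p∪q∣≡∣p∣+∣q∣ {p = inside  ∷ p} {q = outside ∷ q} disjoint =
  cong suc (∣p∪q∣≡∣p∣+∣q∣ λ x∈p x∈q → disjoint (there x∈p) (there x∈q))
∣p∪q∣≡∣p∣+∣q∣ {p = outside ∷ p} {q = inside  ∷ q} disjoint =
  trans (cong suc (∣p∪q∣≡∣p∣+∣q∣ λ x∈p x∈q → disjoint (there x∈p) (there x∈q))) (sym (+-suc ∣ p ∣ ∣ q ∣))
∣p∪q∣≡∣p∣+∣q∣ {p = outside ∷ p} {q = outside ∷ q} disjoint =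
  ∣p∪q∣≡∣p∣+∣q∣ λ x∈p x∈q → disjoint (there x∈p) (there x∈q)

p⊆q⇒∣q∣≡∣p∣+∣q∩∁p∣ : p ⊆ q → ∣ q ∣ ≡ ∣ p ∣ + ∣ q ∩ ∁ p ∣
p⊆q⇒∣q∣≡∣p∣+∣q∩∁p∣ {p = []}          {q = []}          _   = refl
p⊆q⇒∣q∣≡∣p∣+∣q∩∁p∣ {p = inside  ∷ p} {q = inside  ∷ q} p⊆q = cong suc (p⊆q⇒∣q∣≡∣p∣+∣q∩∁p∣ (drop-∷-⊆ p⊆q))
p⊆q⇒∣q∣≡∣p∣+∣q∩∁p∣ {p = inside  ∷ p} {q = outside ∷ q} p⊆q = case p⊆q here of λ ()
p⊆q⇒∣q∣≡∣p∣+∣q∩∁p∣ {p = outside ∷ p} {q = inside  ∷ q} p⊆q =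
  trans (cong suc (p⊆q⇒∣q∣≡∣p∣+∣q∩∁p∣ (drop-∷-⊆ p⊆q))) (sym (+-suc ∣ p ∣ _))
p⊆q⇒∣q∣≡∣p∣+∣q∩∁p∣ {p = outside ∷ p} {q = outside ∷ q} p⊆q = p⊆q⇒∣q∣≡∣p∣+∣q∩∁p∣ (drop-∷-⊆ p⊆q)

x∉p⇒∣p∪⁅x⁆∣≡1+∣p∣ : ∀ {x} → x ∉ p → ∣ p ∪ ⁅ x ⁆ ∣ ≡ suc ∣ p ∣
x∉p⇒∣p∪⁅x⁆∣≡1+∣p∣ {p = p} {x} x∉p = begin
  ∣ p ∪ ⁅ x ⁆ ∣      ≡⟨ ∣p∪q∣≡∣p∣+∣q∣ (λ y∈p y∈⁅x⁆ → x∉p (subst (_∈ p) (x∈⁅y⁆⇒x≡y x y∈⁅x⁆) y∈p)) ⟩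
  ∣ p ∣ + ∣ ⁅ x ⁆ ∣  ≡⟨ cong (∣ p ∣ +_) (∣⁅x⁆∣≡1 x) ⟩
  ∣ p ∣ + 1          ≡⟨ +-comm ∣ p ∣ 1 ⟩
  suc ∣ p ∣          ∎
  where open ≡-Reasoning

x∈p⇒1+∣p∩∁⁅x⁆∣≡∣p∣ : ∀ {x} → x ∈ p → suc ∣ p ∩ ∁ ⁅ x ⁆ ∣ ≡ ∣ p ∣
x∈p⇒1+∣p∩∁⁅x⁆∣≡∣p∣ {p = p} {x} x∈p = begin
  suc ∣ p ∩ ∁ ⁅ x ⁆ ∣          ≡⟨ cong (_+ ∣ p ∩ ∁ ⁅ x ⁆ ∣) (∣⁅x⁆∣≡1 x) ⟨
  ∣ ⁅ x ⁆ ∣ + ∣ p ∩ ∁ ⁅ x ⁆ ∣  ≡⟨ p⊆q⇒∣q∣≡∣p∣+∣q∩∁p∣ (x∈p⇒⁅x⁆⊆p x∈p) ⟨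
  ∣ p ∣                        ∎
  where open ≡-Reasoning

∣p∣≡∑𝟙∈ : (p : Subset n) → ∣ p ∣ ≡ ∑[ x < n ] 𝟙 (x ∈? p)
∣p∣≡∑𝟙∈ []            = refl
∣p∣≡∑𝟙∈ (inside  ∷ p) = cong suc (∣p∣≡∑𝟙∈ p)
∣p∣≡∑𝟙∈ (outside ∷ p) = ∣p∣≡∑𝟙∈ p

C-stepˡ : ∀ n k → n C k ≤ suc n C k
C-stepˡ n zero    = ≤-refl
C-stepˡ n (suc k) = subst (n C suc k ≤_) (nCk+nC[k+1]≡[n+1]C[k+1] n k) (m≤n+m _ _)

C-monoˡ-≤ : ∀ {a b} k → a ≤ b → a C k ≤ b C k
C-monoˡ-≤ k a≤b = go (≤⇒≤′ a≤b)
  where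
  go : ∀ {a b} → a ≤′ b → a C k ≤ b C k
  go ≤′-refl          = ≤-refl
  go (≤′-step a≤′b) = ≤-trans (go a≤′b) (C-stepˡ _ k)

k≤n⇒0<nCk : k ≤ n → 0 < n C k
k≤n⇒0<nCk {zero}              _         = s≤s z≤n
k≤n⇒0<nCk {suc k} {suc n} (s≤s k≤n) =
  subst (0 <_) (nCk+nC[k+1]≡[n+1]C[k+1] n k) (≤-trans (k≤n⇒0<nCk k≤n) (m≤m+n _ _))

C-strictMonoˡ : ∀ {a b} → suc k ≤ b → a < b → a C suc k < b C suc k
C-strictMonoˡ {k} {a} {suc b} (s≤s k≤b) (s≤s a≤b) = begin-strict
  a C suc k                ≤⟨ C-monoˡ-≤ (suc k) a≤b ⟩
  b C suc k                <⟨ m<n+m _ (k≤n⇒0<nCk k≤b) ⟩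
  b C k + b C suc k        ≡⟨ nCk+nC[k+1]≡[n+1]C[k+1] b k ⟩
  suc b C suc k            ∎
  where open ≤-Reasoning

C-cancelˡ-≤ : ∀ {a b} → suc k ≤ a → a C suc k ≤ b C suc k → a ≤ b
C-cancelˡ-≤ {a = a} {b} k<a aCk≤bCk with b <? a
... | yes b<a = contradiction aCk≤bCk (<⇒≱ (C-strictMonoˡ k<a b<a))
... | no  b≮a = ≮⇒≥ b≮a

C-≤-stepʳ : ∀ {a b} → 1 ≤ k → a C k ≤ b C k → a C suc k ≤ b C suc k
C-≤-stepʳ {suc k} {a} {b} _ aCk≤bCk with ≤-total a (suc k)
... | inj₁ a≤k = subst (_≤ b C suc (suc k)) (sym (k>n⇒nCk≡0 (s≤s a≤k))) z≤n
... | inj₂ k≤a = C-monoˡ-≤ (suc (suc k)) (C-cancelˡ-≤ {b = b} k≤a aCk≤bCk)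

T-allIn : (S : Subset n) (p : Fin n → Bool) → T (allIn S p) ⇔ (∀ {u} → u ∈ S → T (p u))
T-allIn {n} S p = mk⇔ to from
  where
  to : T (allIn S p) → ∀ {u} → u ∈ S → T (p u)
  to holds {u} u∈S with All.lookup (all⁺ _ (toList (allFin n)) holds) (∈-toList⁺ (∈-allFin⁺ u))
  ... | holds-at-u with lookup S u | []=⇒lookup u∈S
  ...   | .inside | refl = holds-at-u
  -- allIn tests membership with a where-bound function that cannot be named here, so a
  -- failing conjunct is used to obtain a term mentioning it, which reduces once lookup S u is known
  from : (∀ {u} → u ∈ S → T (p u)) → T (allIn S p)
  from h with T? (allIn S p)
  ... | yes holds = holds
  ... | no fails with satisfied (¬All⇒Any¬ (λ _ → T? _) _ (fails ∘ all⁻ _ {toList (allFin n)}))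
  ...   | u , fails-at-u with lookup S u in eq
  ...     | inside  = ⊥-elim (fails-at-u (h (lookup⇒[]= u S eq)))
  ...     | outside = ⊥-elim (fails-at-u _)

∈-tabulate-if : (b : Fin n → Bool) (x : Fin n) →
                x ∈ tabulate (λ v → if b v then inside else outside) ⇔ T (b x)
∈-tabulate-if b x = mk⇔
  (λ x∈ → T-if (b x) (trans (sym (lookup∘tabulate _ x)) ([]=⇒lookup x∈)))
  (λ Tbx → lookup⇒[]= x _ (trans (lookup∘tabulate _ x) (if-T (b x) Tbx)))
  where
  T-if : ∀ c → (if c then inside else outside) ≡ inside → T c
  T-if true _ = _
  if-T : ∀ c → T c → (if c then inside else outside) ≡ inside
  if-T true _ = refl

module Neighbourhoods {n} (G : Digraph n) where

  infix 4 _⟶_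
  _⟶_ : Fin n → Fin n → Set
  u ⟶ v = T (arc G u v)

  ⟶-irrefl : ∀ {v} → ¬ v ⟶ v
  ⟶-irrefl {v} = subst T (loopless G v)

  private
    variable
      u v : Fin n
      S X Y : Subset n

  ∈-commonOut⁺ : (∀ {u} → u ∈ S → u ⟶ v) → v ∈ commonOut G S
  ∈-commonOut⁺ {S} {v} h = Equivalence.from (∈-tabulate-if _ v) (Equivalence.from (T-allIn S _) h)

  ∈-commonOut⁻ : v ∈ commonOut G S → u ∈ S → u ⟶ v
  ∈-commonOut⁻ {v} {S} v∈ = Equivalence.to (T-allIn S _) (Equivalence.to (∈-tabulate-if _ v) v∈)

  ∈-commonIn⁺ : (∀ {u} → u ∈ S → v ⟶ u) → v ∈ commonIn G S
  ∈-commonIn⁺ {S} {v} h = Equivalence.from (∈-tabulate-if _ v) (Equivalence.from (T-allIn S _) h)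

  ∈-commonIn⁻ : v ∈ commonIn G S → u ∈ S → v ⟶ u
  ∈-commonIn⁻ {v} {S} v∈ = Equivalence.to (T-allIn S _) (Equivalence.to (∈-tabulate-if _ v) v∈)

  ∈-commonOut⇒∉ : v ∈ commonOut G S → v ∉ S
  ∈-commonOut⇒∉ v∈ v∈S = ⟶-irrefl (∈-commonOut⁻ v∈ v∈S)

  ∈-commonIn⇒∉ : v ∈ commonIn G S → v ∉ S
  ∈-commonIn⇒∉ v∈ v∈S = ⟶-irrefl (∈-commonIn⁻ v∈ v∈S)

  commonOut-antimono : X ⊆ Y → commonOut G Y ⊆ commonOut G X
  commonOut-antimono X⊆Y v∈ = ∈-commonOut⁺ λ u∈X → ∈-commonOut⁻ v∈ (X⊆Y u∈X)

  commonIn-antimono : X ⊆ Y → commonIn G Y ⊆ commonIn G X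
  commonIn-antimono X⊆Y v∈ = ∈-commonIn⁺ λ u∈X → ∈-commonIn⁻ v∈ (X⊆Y u∈X)

  ∈-commonOut-∪ : ∀ X Y → v ∈ commonOut G (X ∪ Y) ⇔ (v ∈ commonOut G X × v ∈ commonOut G Y)
  ∈-commonOut-∪ X Y = mk⇔
    (λ v∈ → commonOut-antimono (p⊆p∪q {p = X} Y) v∈ , commonOut-antimono (q⊆p∪q X Y) v∈)
    (λ (v∈X , v∈Y) → ∈-commonOut⁺ λ u∈ →
      [ ∈-commonOut⁻ v∈X , ∈-commonOut⁻ v∈Y ] (x∈p∪q⁻ X Y u∈))

  ⊆-commonOut-commonIn : X ⊆ commonOut G (commonIn G X)
  ⊆-commonOut-commonIn u∈X = ∈-commonOut⁺ λ v∈ → ∈-commonIn⁻ v∈ u∈X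

  ⊆-commonIn⁅⁆ : X ⊆ commonIn G ⁅ v ⁆ ⇔ v ∈ commonOut G X
  ⊆-commonIn⁅⁆ {v = v} = mk⇔
    (λ X⊆ → ∈-commonOut⁺ λ u∈X → ∈-commonIn⁻ (X⊆ u∈X) (x∈⁅x⁆ v))
    (λ v∈ {u} u∈X → ∈-commonIn⁺ λ y∈⁅v⁆ → subst (u ⟶_) (sym (x∈⁅y⁆⇒x≡y v y∈⁅v⁆)) (∈-commonOut⁻ v∈ u∈X))

  ⊆-commonOut⁅⁆ : Y ⊆ commonOut G ⁅ v ⁆ ⇔ v ∈ commonIn G Y
  ⊆-commonOut⁅⁆ {v = v} = mk⇔
    (λ Y⊆ → ∈-commonIn⁺ λ u∈Y → ∈-commonOut⁻ (Y⊆ u∈Y) (x∈⁅x⁆ v))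
    (λ v∈ {u} u∈Y → ∈-commonOut⁺ λ y∈⁅v⁆ → subst (_⟶ u) (sym (x∈⁅y⁆⇒x≡y v y∈⁅v⁆)) (∈-commonIn⁻ v∈ u∈Y))

module Liking⇒TwoWay {n} (G : Digraph n) {j l : ℕ} (1≤l : 1 ≤ l)
                     (liking : Liking (j + suc l) l G) (j+1+l≤n : j + suc l ≤ n) where

  open Neighbourhoods G

  private
    variable
      u v w x : Fin n
      A X Y W : Subset n

  module Relative (R : Subset n) (∣R∣≡j : ∣ R ∣ ≡ j) where

    L : Subset n
    L = commonOut G R

    B O : Fin n → Subset n
    B w = ∁ R ∩ commonIn G ⁅ w ⁆
    O w = L ∩ commonOut G ⁅ w ⁆

    M : Subset n → Subset n
    M Y = ∁ R ∩ commonIn G Y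

    L⊆∁R : L ⊆ ∁ R
    L⊆∁R v∈L = x∉p⇒x∈∁p (∈-commonOut⇒∉ v∈L)

    1+l≤∣∁R∣ : suc l ≤ ∣ ∁ R ∣
    1+l≤∣∁R∣ = begin
      suc l          ≤⟨ m+n≤o⇒m≤o∸n (suc l) (subst (_≤ n) (+-comm j (suc l)) j+1+l≤n) ⟩
      n ∸ j          ≡⟨ cong (n ∸_) ∣R∣≡j ⟨
      n ∸ ∣ R ∣      ≡⟨ ∣∁p∣≡n∸∣p∣ R ⟨
      ∣ ∁ R ∣        ∎
      where open ≤-Reasoning

    liking-∪ : X ⊆[ suc l ] ∁ R → ∣ commonOut G (R ∪ X) ∣ ≡ l
    liking-∪ {X} (X⊆∁R , ∣X∣≡1+l) = liking (R ∪ X) (begin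
      ∣ R ∪ X ∣      ≡⟨ ∣p∪q∣≡∣p∣+∣q∣ (λ x∈R x∈X → x∈∁p⇒x∉p (X⊆∁R x∈X) x∈R) ⟩
      ∣ R ∣ + ∣ X ∣  ≡⟨ cong₂ _+_ ∣R∣≡j ∣X∣≡1+l ⟩
      j + suc l      ∎)
      where open ≡-Reasoning

    ∣commonOut-∪∣≤l : A ⊆ ∁ R → suc l ≤ ∣ A ∣ → ∣ commonOut G (R ∪ A) ∣ ≤ l
    ∣commonOut-∪∣≤l {A} A⊆∁R 1+l≤∣A∣ with choose A 1+l≤∣A∣
    ... | X , X⊆A , ∣X∣≡1+l = begin
      ∣ commonOut G (R ∪ A) ∣  ≤⟨ p⊆q⇒∣p∣≤∣q∣ (commonOut-antimono R∪X⊆R∪A) ⟩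
      ∣ commonOut G (R ∪ X) ∣  ≡⟨ liking-∪ ((λ x∈X → A⊆∁R (X⊆A x∈X)) , ∣X∣≡1+l) ⟩
      l                        ∎
      where
      open ≤-Reasoning
      R∪X⊆R∪A : R ∪ X ⊆ R ∪ A
      R∪X⊆R∪A = ∪-⊆ (p⊆p∪q A) (q⊆p∪q R A ∘ X⊆A)

    ∣M∣≤l : Y ⊆[ suc l ] L → ∣ M Y ∣ ≤ l
    ∣M∣≤l {Y} (Y⊆L , ∣Y∣≡1+l) with suc l ≤? ∣ M Y ∣
    ... | no  ∣MY∣≤l  = ≤-pred (≰⇒> ∣MY∣≤l)
    ... | yes 1+l≤∣MY∣ = contradiction (begin
      suc l                      ≡⟨ ∣Y∣≡1+l ⟨
      ∣ Y ∣                      ≤⟨ p⊆q⇒∣p∣≤∣q∣ Y⊆commonOut ⟩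
      ∣ commonOut G (R ∪ M Y) ∣  ≤⟨ ∣commonOut-∪∣≤l (p∩q⊆p (∁ R) (commonIn G Y)) 1+l≤∣MY∣ ⟩
      l                          ∎) (n≮n l)
      where
      open ≤-Reasoning
      Y⊆commonOut : Y ⊆ commonOut G (R ∪ M Y)
      Y⊆commonOut y∈Y = Equivalence.from (∈-commonOut-∪ R (M Y))
        (Y⊆L y∈Y , commonOut-antimono (p∩q⊆q (∁ R) (commonIn G Y)) (⊆-commonOut-commonIn y∈Y))

    count-in : ∑[ w < n ] (𝟙 (w ∈? L) * (∣ B w ∣ C suc l)) ≡ l * (∣ ∁ R ∣ C suc l)
    count-in = begin
      ∑[ w < n ] (𝟙 (w ∈? L) * (∣ B w ∣ C suc l))
        ≡⟨ sum-cong-≗ (λ w → cong (𝟙 (w ∈? L) *_) (∑ₛ-⊆[]≡C (suc l) (B w))) ⟨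
      ∑[ w < n ] (𝟙 (w ∈? L) * ∑ₛ (λ X → 𝟙 (X ⊆[ suc l ]? B w)))
        ≡⟨ ∑-𝟙*∑ₛ-𝟙-swap (_∈? L) (λ w X → X ⊆[ suc l ]? B w)
                          (_⊆[ suc l ]? ∁ R) (λ X w → w ∈? commonOut G (R ∪ X)) regroup ⟩
      ∑ₛ (λ X → 𝟙 (X ⊆[ suc l ]? ∁ R) * ∑[ w < n ] 𝟙 (w ∈? commonOut G (R ∪ X)))
        ≡⟨ ∑ₛ-cong (λ X → 𝟙-*-cong (X ⊆[ suc l ]? ∁ R) λ X-ok →
                     trans (sym (∣p∣≡∑𝟙∈ (commonOut G (R ∪ X)))) (liking-∪ X-ok)) ⟩
      ∑ₛ (λ X → 𝟙 (X ⊆[ suc l ]? ∁ R) * l)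
        ≡⟨ ∑ₛ-⊆[]*≡*C l (suc l) (∁ R) ⟩
      l * (∣ ∁ R ∣ C suc l)
        ∎
      where
      open ≡-Reasoning
      regroup : ∀ w X → (w ∈ L × X ⊆[ suc l ] B w) ⇔ (X ⊆[ suc l ] ∁ R × w ∈ commonOut G (R ∪ X))
      regroup w X = mk⇔
        (λ (w∈L , X⊆B , ∣X∣) → let X⊆∁R , X⊆In = Equivalence.to ⊆-∩ X⊆B in
          (X⊆∁R , ∣X∣) , Equivalence.from (∈-commonOut-∪ R X) (w∈L , Equivalence.to ⊆-commonIn⁅⁆ X⊆In))
        (λ ((X⊆∁R , ∣X∣) , w∈) → let w∈L , w∈OutX = Equivalence.to (∈-commonOut-∪ R X) w∈ in
          w∈L , Equivalence.from ⊆-∩ (X⊆∁R , Equivalence.from ⊆-commonIn⁅⁆ w∈OutX) , ∣X∣)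

    module _ {w} (w∈L : w ∈ L) where

      private
        D : Subset n → Subset n
        D Λ = commonOut G (R ∪ (Λ ∪ ⁅ w ⁆))

        w∈commonOut : X ⊆[ l ] B w → w ∈ commonOut G X
        w∈commonOut (X⊆B , _) = Equivalence.to ⊆-commonIn⁅⁆ (p∩q⊆q (∁ R) _ ∘ X⊆B)

        add-w : X ⊆[ l ] B w → X ∪ ⁅ w ⁆ ⊆[ suc l ] ∁ R
        add-w {X} X-ok@(X⊆B , ∣X∣≡l) =
          ∪-⊆ (p∩q⊆p (∁ R) _ ∘ X⊆B) (x∈p⇒⁅x⁆⊆p (L⊆∁R w∈L)) ,
          trans (x∉p⇒∣p∪⁅x⁆∣≡1+∣p∣ {p = X} (∈-commonOut⇒∉ (w∈commonOut X-ok))) (cong suc ∣X∣≡l)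

        D-⊆[] : X ⊆[ l ] B w → D X ⊆[ l ] O w
        D-⊆[] {X} X-ok = (λ v∈D → let v∈L , v∈Out = Equivalence.to (∈-commonOut-∪ R (X ∪ ⁅ w ⁆)) v∈D in
                            x∈p∩q⁺ (v∈L , commonOut-antimono (q⊆p∪q X ⁅ w ⁆) v∈Out)) ,
                         liking-∪ (add-w X-ok)

        D⊆commonOut : X ⊆[ l ] B w → D X ⊆ commonOut G X
        D⊆commonOut {X} _ v∈D = commonOut-antimono (λ x∈X → q⊆p∪q R (X ∪ ⁅ w ⁆) (p⊆p∪q ⁅ w ⁆ x∈X)) v∈D

        D≡⇒⊇ : X ⊆[ l ] B w → Y ⊆[ l ] B w → D X ≡ D Y → Y ⊆ X
        D≡⇒⊇ {X} {Y} X-ok@(X⊆B , ∣X∣≡l) Y-ok@(Y⊆B , _) DX≡DY =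
          ⊆-trans (q⊆p∪q X Y) (p⊆q∧∣q∣≤∣p∣⇒q⊆p (p⊆p∪q Y) (≤-trans ∣X∪Y∣≤l (≤-reflexive (sym ∣X∣≡l))))
          where
          X∪Y⊆∁R : X ∪ Y ⊆ ∁ R
          X∪Y⊆∁R = ∪-⊆ (p∩q⊆p (∁ R) _ ∘ X⊆B) (p∩q⊆p (∁ R) _ ∘ Y⊆B)
          -- D X and w are l + 1 common out-neighbours of R ∪ X ∪ Y, so X ∪ Y must be small
          DX∪w⊆commonOut : D X ∪ ⁅ w ⁆ ⊆ commonOut G (R ∪ (X ∪ Y))
          DX∪w⊆commonOut = ∪-⊆ DX⊆ (x∈p⇒⁅x⁆⊆p w∈)
            where
            DX⊆ : D X ⊆ commonOut G (R ∪ (X ∪ Y))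
            DX⊆ v∈DX = Equivalence.from (∈-commonOut-∪ R (X ∪ Y))
              (commonOut-antimono (p⊆p∪q {p = R} (X ∪ ⁅ w ⁆)) v∈DX ,
               Equivalence.from (∈-commonOut-∪ X Y)
                 (D⊆commonOut X-ok v∈DX , D⊆commonOut Y-ok (subst (_ ∈_) DX≡DY v∈DX)))
            w∈ : w ∈ commonOut G (R ∪ (X ∪ Y))
            w∈ = Equivalence.from (∈-commonOut-∪ R (X ∪ Y))
              (w∈L , Equivalence.from (∈-commonOut-∪ X Y) (w∈commonOut X-ok , w∈commonOut Y-ok))
          ∣X∪Y∣≤l : ∣ X ∪ Y ∣ ≤ l
          ∣X∪Y∣≤l with suc l ≤? ∣ X ∪ Y ∣
          ... | no  ∣X∪Y∣≤l  = ≤-pred (≰⇒> ∣X∪Y∣≤l)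
          ... | yes 1+l≤∣X∪Y∣ = contradiction (begin
            suc l                            ≡⟨ cong suc (proj₂ (D-⊆[] X-ok)) ⟨
            suc ∣ D X ∣                      ≡⟨ x∉p⇒∣p∪⁅x⁆∣≡1+∣p∣ (λ w∈DX → ∈-commonOut⇒∉ w∈DX w∈R∪X∪w) ⟨
            ∣ D X ∪ ⁅ w ⁆ ∣                  ≤⟨ p⊆q⇒∣p∣≤∣q∣ DX∪w⊆commonOut ⟩
            ∣ commonOut G (R ∪ (X ∪ Y)) ∣    ≤⟨ ∣commonOut-∪∣≤l X∪Y⊆∁R 1+l≤∣X∪Y∣ ⟩
            l                                ∎) (n≮n l)
            where
            open ≤-Reasoning
            w∈R∪X∪w : w ∈ R ∪ (X ∪ ⁅ w ⁆)
            w∈R∪X∪w = q⊆p∪q R (X ∪ ⁅ w ⁆) (q⊆p∪q X ⁅ w ⁆ (x∈⁅x⁆ w))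

      ∣B∣C≤∣O∣C : ∣ B w ∣ C l ≤ ∣ O w ∣ C l
      ∣B∣C≤∣O∣C = begin
        ∣ B w ∣ C l                  ≡⟨ ∑ₛ-⊆[]≡C l (B w) ⟨
        ∑ₛ (λ X → 𝟙 (X ⊆[ l ]? B w))  ≤⟨ ∑ₛ-𝟙-injection (_⊆[ l ]? B w) (_⊆[ l ]? O w) D D-⊆[]
                                           (λ X-ok Y-ok DX≡DY → ⊆-antisym (D≡⇒⊇ Y-ok X-ok (sym DX≡DY))
                                                                          (D≡⇒⊇ X-ok Y-ok DX≡DY)) ⟩
        ∑ₛ (λ Y → 𝟙 (Y ⊆[ l ]? O w))  ≡⟨ ∑ₛ-⊆[]≡C l (O w) ⟩
        ∣ O w ∣ C l                  ∎
        where open ≤-Reasoning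

    count-in≤count-out : ∑[ w < n ] (𝟙 (w ∈? L) * (∣ B w ∣ C suc l)) ≤
                         ∑[ w < n ] (𝟙 (w ∈? ∁ R) * (∣ O w ∣ C suc l))
    count-in≤count-out = ∑-mono-≤ λ w →
      𝟙-*-mono (w ∈? L) (w ∈? ∁ R) L⊆∁R (λ w∈L → C-≤-stepʳ 1≤l (∣B∣C≤∣O∣C w∈L))

    count-out : ∑[ x < n ] (𝟙 (x ∈? ∁ R) * (∣ O x ∣ C suc l)) ≡ ∑ₛ (λ Y → 𝟙 (Y ⊆[ suc l ]? L) * ∣ M Y ∣)
    count-out = begin
      ∑[ x < n ] (𝟙 (x ∈? ∁ R) * (∣ O x ∣ C suc l))
        ≡⟨ sum-cong-≗ (λ x → cong (𝟙 (x ∈? ∁ R) *_) (∑ₛ-⊆[]≡C (suc l) (O x))) ⟨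
      ∑[ x < n ] (𝟙 (x ∈? ∁ R) * ∑ₛ (λ Y → 𝟙 (Y ⊆[ suc l ]? O x)))
        ≡⟨ ∑-𝟙*∑ₛ-𝟙-swap (_∈? ∁ R) (λ x Y → Y ⊆[ suc l ]? O x)
                          (_⊆[ suc l ]? L) (λ Y x → x ∈? M Y) regroup ⟩
      ∑ₛ (λ Y → 𝟙 (Y ⊆[ suc l ]? L) * ∑[ x < n ] 𝟙 (x ∈? M Y))
        ≡⟨ ∑ₛ-cong (λ Y → cong (𝟙 (Y ⊆[ suc l ]? L) *_) (∣p∣≡∑𝟙∈ (M Y))) ⟨
      ∑ₛ (λ Y → 𝟙 (Y ⊆[ suc l ]? L) * ∣ M Y ∣)
        ∎
      where
      open ≡-Reasoning
      regroup : ∀ x Y → (x ∈ ∁ R × Y ⊆[ suc l ] O x) ⇔ (Y ⊆[ suc l ] L × x ∈ M Y)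
      regroup x Y = mk⇔
        (λ (x∈∁R , Y⊆O , ∣Y∣) → let Y⊆L , Y⊆Out = Equivalence.to ⊆-∩ Y⊆O in
          (Y⊆L , ∣Y∣) , x∈p∩q⁺ (x∈∁R , Equivalence.to ⊆-commonOut⁅⁆ Y⊆Out))
        (λ ((Y⊆L , ∣Y∣) , x∈M) → let x∈∁R , x∈In = x∈p∩q⁻ (∁ R) (commonIn G Y) x∈M in
          x∈∁R , Equivalence.from ⊆-∩ (Y⊆L , Equivalence.from ⊆-commonOut⁅⁆ x∈In) , ∣Y∣)

    l*∣∁R∣C≤weighted-∣M∣ : l * (∣ ∁ R ∣ C suc l) ≤ ∑ₛ (λ Y → 𝟙 (Y ⊆[ suc l ]? L) * ∣ M Y ∣)
    l*∣∁R∣C≤weighted-∣M∣ = begin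
      l * (∣ ∁ R ∣ C suc l)                         ≡⟨ count-in ⟨
      ∑[ w < n ] (𝟙 (w ∈? L) * (∣ B w ∣ C suc l))   ≤⟨ count-in≤count-out ⟩
      ∑[ x < n ] (𝟙 (x ∈? ∁ R) * (∣ O x ∣ C suc l)) ≡⟨ count-out ⟩
      ∑ₛ (λ Y → 𝟙 (Y ⊆[ suc l ]? L) * ∣ M Y ∣)      ∎
      where open ≤-Reasoning

    weighted-∣M∣≤weighted-l : ∑ₛ (λ Y → 𝟙 (Y ⊆[ suc l ]? L) * ∣ M Y ∣) ≤ ∑ₛ (λ Y → 𝟙 (Y ⊆[ suc l ]? L) * l)
    weighted-∣M∣≤weighted-l = ∑ₛ-mono-≤ λ Y → 𝟙-*-mono (Y ⊆[ suc l ]? L) (Y ⊆[ suc l ]? L) id ∣M∣≤l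

    weighted-l≤l*∣∁R∣C : ∑ₛ (λ Y → 𝟙 (Y ⊆[ suc l ]? L) * l) ≤ l * (∣ ∁ R ∣ C suc l)
    weighted-l≤l*∣∁R∣C = begin
      ∑ₛ (λ Y → 𝟙 (Y ⊆[ suc l ]? L) * l)  ≡⟨ ∑ₛ-⊆[]*≡*C l (suc l) L ⟩
      l * (∣ L ∣ C suc l)                 ≤⟨ *-monoʳ-≤ l (C-monoˡ-≤ (suc l) (p⊆q⇒∣p∣≤∣q∣ L⊆∁R)) ⟩
      l * (∣ ∁ R ∣ C suc l)               ∎
      where open ≤-Reasoning

    ∁R⊆L : ∁ R ⊆ L
    ∁R⊆L = p⊆q∧∣q∣≤∣p∣⇒q⊆p L⊆∁R (C-cancelˡ-≤ 1+l≤∣∁R∣ (*-cancelˡ-≤ l ⦃ >-nonZero 1≤l ⦄ (begin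
      l * (∣ ∁ R ∣ C suc l)                     ≤⟨ l*∣∁R∣C≤weighted-∣M∣ ⟩
      ∑ₛ (λ Y → 𝟙 (Y ⊆[ suc l ]? L) * ∣ M Y ∣)  ≤⟨ weighted-∣M∣≤weighted-l ⟩
      ∑ₛ (λ Y → 𝟙 (Y ⊆[ suc l ]? L) * l)        ≡⟨ ∑ₛ-⊆[]*≡*C l (suc l) L ⟩
      l * (∣ L ∣ C suc l)                       ∎)))
      where open ≤-Reasoning

    ∣M∣≡l : Y ⊆[ suc l ] ∁ R → ∣ M Y ∣ ≡ l
    ∣M∣≡l {Y} (Y⊆∁R , ∣Y∣≡1+l) = *-cancelˡ-≡ _ _ 1 (subst (λ c → c * ∣ M Y ∣ ≡ c * l) 𝟙≡1
      (∑ₛ-≤-≡⇒≗ (λ Y → 𝟙-*-mono (Y ⊆[ suc l ]? L) (Y ⊆[ suc l ]? L) id ∣M∣≤l) weighted-∣M∣≡weighted-l Y))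
      where
      𝟙≡1 : 𝟙 (Y ⊆[ suc l ]? L) ≡ 1
      𝟙≡1 = 𝟙-yes (Y ⊆[ suc l ]? L) (⊆-trans Y⊆∁R ∁R⊆L , ∣Y∣≡1+l)
      weighted-∣M∣≡weighted-l = ≤-antisym weighted-∣M∣≤weighted-l
        (≤-trans weighted-l≤l*∣∁R∣C l*∣∁R∣C≤weighted-∣M∣)

  ∉⟶∈ : ∀ {R} → ∣ R ∣ ≡ j → x ∉ R → u ∈ R → x ⟶ u
  ∉⟶∈ {x} {u} {R} ∣R∣≡j x∉R u∈R =
    ∈-commonOut⁻ (Relative.∁R⊆L R′ ∣R′∣≡j (x∉p⇒x∈∁p u∉R′)) (q⊆p∪q (R ∩ ∁ ⁅ u ⁆) ⁅ x ⁆ (x∈⁅x⁆ x))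
    where
    R′ : Subset n
    R′ = (R ∩ ∁ ⁅ u ⁆) ∪ ⁅ x ⁆
    ∣R′∣≡j : ∣ R′ ∣ ≡ j
    ∣R′∣≡j = trans (x∉p⇒∣p∪⁅x⁆∣≡1+∣p∣ (x∉R ∘ p∩q⊆p R (∁ ⁅ u ⁆))) (trans (x∈p⇒1+∣p∩∁⁅x⁆∣≡∣p∣ u∈R) ∣R∣≡j)
    u∉R′ : u ∉ R′
    u∉R′ u∈R′ with x∈p∪q⁻ (R ∩ ∁ ⁅ u ⁆) ⁅ x ⁆ u∈R′
    ... | inj₁ u∈R∩∁u = x∈∁p⇒x∉p (p∩q⊆q R (∁ ⁅ u ⁆) u∈R∩∁u) (x∈⁅x⁆ u)
    ... | inj₂ u∈⁅x⁆  = x∉R (subst (_∈ R) (x∈⁅y⁆⇒x≡y x u∈⁅x⁆) u∈R)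

  ∣commonIn∣≡l : ∣ W ∣ ≡ j + suc l → ∣ commonIn G W ∣ ≡ l
  ∣commonIn∣≡l {W} ∣W∣≡j+1+l with choose W (subst (j ≤_) (sym ∣W∣≡j+1+l) (m≤m+n j (suc l)))
  ... | R , R⊆W , ∣R∣≡j =
    trans (cong ∣_∣ commonIn-W≡M) (Relative.∣M∣≡l R ∣R∣≡j (p∩q⊆q W (∁ R) , ∣W∖R∣≡1+l))
    where
    W∖R : Subset n
    W∖R = W ∩ ∁ R
    ∣W∖R∣≡1+l : ∣ W∖R ∣ ≡ suc l
    ∣W∖R∣≡1+l = +-cancelˡ-≡ j _ _ (begin
      j + ∣ W∖R ∣      ≡⟨ cong (_+ ∣ W∖R ∣) ∣R∣≡j ⟨
      ∣ R ∣ + ∣ W∖R ∣  ≡⟨ p⊆q⇒∣q∣≡∣p∣+∣q∩∁p∣ R⊆W ⟨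
      ∣ W ∣          ≡⟨ ∣W∣≡j+1+l ⟩
      j + suc l      ∎)
      where open ≡-Reasoning
    commonIn-W≡M : commonIn G W ≡ ∁ R ∩ commonIn G W∖R
    commonIn-W≡M = ⊆-antisym
      (λ v∈ → x∈p∩q⁺ (x∉p⇒x∈∁p (∈-commonIn⇒∉ v∈ ∘ R⊆W) , commonIn-antimono (p∩q⊆p W (∁ R)) v∈))
      (λ v∈ → let v∈∁R , v∈In = x∈p∩q⁻ (∁ R) (commonIn G W∖R) v∈ in
              ∈-commonIn⁺ {S = W} λ {u} u∈W → case u ∈? R of λ where
        (yes u∈R) → ∉⟶∈ ∣R∣≡j (x∈∁p⇒x∉p v∈∁R) u∈R
        (no  u∉R) → ∈-commonIn⁻ v∈In (x∈p∩q⁺ (u∈W , x∉p⇒x∈∁p u∉R)))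

liking⇒two-way : ∀ {n j l} {G : Digraph n} → 1 ≤ l → Liking (j + suc l) l G → TwoWayLiking (j + suc l) l G
liking⇒two-way {n} {G = G} 1≤l liking S ∣S∣≡t =
  liking S ∣S∣≡t , Liking⇒TwoWay.∣commonIn∣≡l G 1≤l liking (subst (_≤ n) ∣S∣≡t (∣p∣≤n S)) {W = S} ∣S∣≡t

two-way⇒liking : ∀ {n t l} {G : Digraph n} → TwoWayLiking t l G → Liking t l G
two-way⇒liking two-way S ∣S∣≡t = proj₁ (two-way S ∣S∣≡t)

corollary4p2 : (t λ' : ℕ) → 1 ≤ t → 1 ≤ λ' → λ' + 1 ≤ t →
    (n : ℕ) (G : Digraph n) → Liking t λ' G ⇔ TwoWayLiking t λ' G
corollary4p2 t λ' _ 1≤λ' λ'+1≤t n G with t ∸ suc λ' | m∸n+n≡m (subst (_≤ t) (+-comm λ' 1) λ'+1≤t)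
... | j | refl = mk⇔ (liking⇒two-way {j = j} {l = λ'} {G = G} 1≤λ') (two-way⇒liking {G = G})
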